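{- Let $n$ be a positive integer and let $\mathrm{sf}(n)$ denote its squarefree part. Let $D$ be a negative integer with $D\equiv 0,1\pmod 4$ and $\gcd(n,D)=1$. The following are equivalent: (1) No positive definite binary $\mathbb{Z}$-lattice $\ell$ with $\mathfrak{n}\ell=\mathbb{Z}$ and $D_\ell=D$ represents $n$. (2) There is a prime $p$ dividing $\mathrm{sf}(n)$ such that $\left(\frac{D}{p}\right)=-1$.
   Context: A $\mathbb{Z}$-lattice is a free $\mathbb{Z}$-module with a positive definite symmetric bilinear form $B$ (rational values), $Q(x)=B(x,x)$; $\mathfrak{n}\ell$ is the $\mathbb{Z}$-module generated by $\{Q(x):x\in\ell\}$. For a binary lattice with Gram matrix $\begin{pmatrix} a & b/2\\ b/2 & c\end{pmatrix}$, $D_\ell=b^2-4ac$, and $\mathfrak{n}\ell=\gcd(a,b,c)\mathbb{Z}$. $\ell$ represents $n$ if $Q(x)=n$ for some $x\in\ell$. The squarefree part $\mathrm{sf}(n)$ is the unique squarefree $s$ with $n=sm^2$. $\left(\frac{D}{p}\right)$ is the Kronecker symbol. -}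

module Defs where

open import Data.Nat as ℕ using (ℕ; zero; suc)
open import Data.Nat.Divisibility as ℕD using ()
open import Data.Nat.Primality using (Prime)
open import Data.Integer as ℤ using (ℤ; +_; -_; _-_; _*_; _+_; _<_)
open import Data.Integer.Divisibility using (_∣_)
open import Data.Integer.Divisibility.Signed using (_∣?_)
open import Data.Integer.GCD using (gcd)
open import Data.Integer.DivMod using (_%ℕ_)
open import Data.List using (upTo; map)
open import Data.List.Relation.Unary.Any using (any?)
open import Data.Product using (Σ; _×_; ∃; ∃-syntax)
open import Relation.Binary.PropositionalEquality using (_≡_)
open import Relation.Nullary using (does)
open import Data.Bool using (if_then_else_)

Squarefree : ℕ → Set
Squarefree s = ∀ (d : ℕ) → (d ℕ.* d) ℕD.∣ s → d ≡ 1

IsSquarefreePart : ℕ → ℕ → Set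
IsSquarefreePart n s = Squarefree s × ∃[ m ] (n ≡ s ℕ.* (m ℕ.* m))

-- Kronecker symbol (D / p) at a prime p (value meaningless for non-prime p).
-- p = 2 : 0 if D even, 1 if D ≡ ±1 (mod 8), -1 if D ≡ ±3 (mod 8).
-- p odd : Legendre symbol: 0 if p ∣ D, 1 if D is a square mod p, -1 otherwise.
kronecker2 : ℕ → ℤ
kronecker2 1 = + 1
kronecker2 7 = + 1
kronecker2 3 = - (+ 1)
kronecker2 5 = - (+ 1)
kronecker2 _ = + 0

kronecker : ℤ → ℕ → ℤ
kronecker D 2 = kronecker2 (D %ℕ 8)
kronecker D p =
  if does ((+ p) ∣? D) then + 0
  else if does (any? (λ x → (+ p) ∣? ((+ x) * (+ x) - D)) (upTo p)) then + 1
  else - (+ 1)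

-- Binary quadratic form a x² + b x y + c y², i.e. the Z-lattice with Gram
-- matrix [[a, b/2], [b/2, c]].
Q : ℤ → ℤ → ℤ → ℤ → ℤ → ℤ
Q a b c x y = a * x * x + b * x * y + c * y * y

disc : ℤ → ℤ → ℤ → ℤ
disc a b c = b * b - (+ 4) * a * c

PosDef : ℤ → ℤ → ℤ → Set
PosDef a b c = (+ 0 < a) × (disc a b c < + 0)

-- norm ideal 𝔫ℓ = gcd(a,b,c) ℤ equals ℤ
NormOne : ℤ → ℤ → ℤ → Set
NormOne a b c = gcd (gcd a b) c ≡ + 1

Represents : ℤ → ℤ → ℤ → ℕ → Set
Represents a b c n = ∃[ x ] ∃[ y ] (Q a b c x y ≡ + n)

{-# OPTIONS --safe #-}
-- If p ∣ sf(n) and (D/p) = −1, then D is not a square modulo p (modulo 8 when p = 2), and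
-- 4a·Q(x,y) = (2ax + by)² − D y² shows that p ∣ Q(x,y) forces p ∣ x and p ∣ y. Writing
-- n = p t m² with p ∤ t, a representation of n therefore descends to one of p t (m/p)²,
-- which is absurd by infinite descent on m.
-- Conversely, if (D/p) ≠ −1 for every prime p ∣ s, then D is a square modulo 4p for each
-- such p, hence modulo 4s by the Chinese remainder theorem since s is squarefree. A root
-- b² − D = 4sc gives the form [s, b, c] of discriminant D; it is primitive because
-- gcd(s, b) divides gcd(n, D) = 1, and it represents n = s m² at (m, 0). Whether such a
-- prime p ≤ s exists is decidable, so the contrapositive proves the equivalence
-- constructively.
module Submission where

open import Defs
open import Data.Nat as ℕ using (ℕ; NonZero)
open import Data.Nat.Divisibility as ℕD using ()
open import Data.Nat.Primality using (Prime)
open import Data.Nat.Coprimality using (Coprime)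
open import Data.Integer as ℤ using (ℤ; +_; -_; _-_; _<_; ∣_∣)
open import Data.Integer.Divisibility using (_∣_)
open import Data.Product using (_×_; ∃-syntax)
open import Data.Sum using (_⊎_)
open import Relation.Nullary using (¬_)
open import Function.Bundles using (_⇔_)
open import Relation.Binary.PropositionalEquality using (_≡_)

open import Data.Bool using (if_then_else_)
open import Data.Integer using (_*_; _+_; 0ℤ; 1ℤ; -1ℤ)
import Data.Integer.Properties as ℤ
open import Data.Integer.DivMod using (_%ℕ_; _/ℕ_; a≡a%ℕn+[a/ℕn]*n; n%ℕd<d)
open import Data.Integer.Divisibility.Signed as ℤ∣ using (divides; ∣ᵤ⇒∣; ∣⇒∣ᵤ)
  renaming (_∣_ to _∣ℤ_)
import Data.Integer.GCD as ℤGCD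
open import Data.Integer.Tactic.RingSolver using (solve; solve-∀)
open import Data.List using ([]; _∷_; upTo)
open import Data.List.Membership.Propositional.Properties using (∈-upTo⁺)
open import Data.List.Relation.Unary.All as All using (All)
open import Data.List.Relation.Unary.Any as Any using (Any; any?)
open import Data.Nat using (suc; nonTrivial⇒≢1; nonTrivial⇒n>1)
import Data.Nat.Properties as ℕ
open import Data.Nat.Coprimality as Cop
  using (coprime-Bézout; coprime-divisor; coprime⇒gcd≡1; prime⇒coprime)
open import Data.Nat.GCD as ℕGCD using (module Bézout)
open import Data.Nat.Induction using (<-wellFounded)
open import Data.Nat.LCM using (lcm; lcm-least; gcd*lcm)
open import Data.Nat.ListAction using (product)
open import Data.Nat.Primality
  using (euclidsLemma; prime⇒irreducible; prime⇒nonTrivial; prime⇒nonZero; prime?)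
open import Data.Nat.Primality.Factorisation using (factorise; PrimeFactorisation)
import Data.Nat.Tactic.RingSolver as ℕSolver
open import Data.Product using (_,_)
open import Data.Sum as Sum using (inj₁; inj₂)
open import Function using (_∘_)
open import Function.Bundles using (mk⇔; Equivalence)
open import Induction.WellFounded using (Acc; acc)
open import Relation.Binary.PropositionalEquality
  using (_≢_; refl; sym; trans; cong; cong₂; subst; module ≡-Reasoning)
open import Relation.Nullary using (Dec; yes; no; does; contradiction)
open import Relation.Nullary.Decidable using (from-yes; decidable-stable; ¬?; _×-dec_; _→-dec_)
import Relation.Nullary.Decidable as Dec

private
  variable
    w x y z D D′ : ℤ
    k m n p s t : ℕ

prime∤⇒coprime : Prime p → ¬ p ℕD.∣ n → Coprime p n
prime∤⇒coprime pr p∤n (d∣p , d∣n) with prime⇒irreducible pr d∣p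
... | inj₁ d≡1 = d≡1
... | inj₂ refl = contradiction d∣n p∤n

coprime-*ˡ : Coprime m n → Coprime k n → Coprime (m ℕ.* k) n
coprime-*ˡ {m} m⊥n k⊥n {d} (d∣mk , d∣n) = k⊥n (coprime-divisor d⊥m d∣mk , d∣n)
  where
  d⊥m : Coprime d m
  d⊥m (e∣d , e∣m) = m⊥n (e∣m , ℕD.∣-trans e∣d d∣n)

coprime-∣⇒*∣ : Coprime m k → m ℕD.∣ n → k ℕD.∣ n → m ℕ.* k ℕD.∣ n
coprime-∣⇒*∣ {m} {k} m⊥k m∣n k∣n = subst (ℕD._∣ _) lcm≡m*k (lcm-least m∣n k∣n)
  where
  lcm≡m*k : lcm m k ≡ m ℕ.* k
  lcm≡m*k = trans (sym (ℕ.*-identityˡ (lcm m k)))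
                  (trans (cong (ℕ._* lcm m k) (sym (coprime⇒gcd≡1 m⊥k))) (gcd*lcm m k))

euclidsLemmaℤ : ∀ i j → Prime p → + p ∣ℤ i * j → + p ∣ℤ i ⊎ + p ∣ℤ j
euclidsLemmaℤ i j pr p∣ij =
  Sum.map ∣ᵤ⇒∣ ∣ᵤ⇒∣ (euclidsLemma ∣ i ∣ ∣ j ∣ pr (subst (_ ℕD.∣_) (ℤ.abs-* i j) (∣⇒∣ᵤ p∣ij)))

infix 4 _≡_mod_

-- A record rather than a definition: _*_ and _-_ on ℤ unfold on sight, so implicit
-- arguments could not be recovered from an unfolded x - y.
record _≡_mod_ (x y : ℤ) (m : ℕ) : Set where
  constructor congruent
  field ∣-diff : + m ∣ℤ x - y

open _≡_mod_

≡mod-sym : x ≡ y mod m → y ≡ x mod m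
≡mod-sym {x} {y} (congruent m∣x-y) = congruent (subst (_ ∣ℤ_) negate (ℤ∣.∣m⇒∣-m m∣x-y))
  where
  negate : - (x - y) ≡ y - x
  negate = solve (x ∷ y ∷ [])

≡mod-trans : x ≡ y mod m → y ≡ z mod m → x ≡ z mod m
≡mod-trans {x} {y} {z = z} (congruent m∣x-y) (congruent m∣y-z) =
  congruent (subst (_ ∣ℤ_) telescope (ℤ∣.∣m∣n⇒∣m+n m∣x-y m∣y-z))
  where
  telescope : x - y + (y - z) ≡ x - z
  telescope = solve (x ∷ y ∷ z ∷ [])

≡mod-* : x ≡ y mod m → z ≡ w mod m → x * z ≡ y * w mod m
≡mod-* {x} {y} {z = z} {w} (congruent m∣x-y) (congruent m∣z-w) =
  congruent (subst (_ ∣ℤ_) split (ℤ∣.∣m∣n⇒∣m+n (ℤ∣.∣m⇒∣m*n z m∣x-y) (ℤ∣.∣n⇒∣m*n y m∣z-w)))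
  where
  split : (x - y) * z + y * (z - w) ≡ x * z - y * w
  split = solve (x ∷ y ∷ z ∷ w ∷ [])

≡mod-∣ : m ℕD.∣ k → x ≡ y mod k → x ≡ y mod m
≡mod-∣ m∣k (congruent k∣x-y) = congruent (ℤ∣.∣-trans (∣ᵤ⇒∣ m∣k) k∣x-y)

≡mod-%ℕ : ∀ z m .{{_ : NonZero m}} → z ≡ + (z %ℕ m) mod m
≡mod-%ℕ z m = congruent (divides (z /ℕ m) (begin
  z - r                  ≡⟨ cong (_- r) (a≡a%ℕn+[a/ℕn]*n z m) ⟩
  r + z /ℕ m * + m - r   ≡⟨ cancel r (z /ℕ m * + m) ⟩
  z /ℕ m * + m           ∎))
  where
  open ≡-Reasoning
  r = + (z %ℕ m)
  cancel : ∀ i j → i + j - i ≡ j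
  cancel = solve-∀

≡mod-coprime-* : Coprime m k → x ≡ y mod m → x ≡ y mod k → x ≡ y mod (m ℕ.* k)
≡mod-coprime-* m⊥k (congruent m∣x-y) (congruent k∣x-y) =
  congruent (∣ᵤ⇒∣ (coprime-∣⇒*∣ m⊥k (∣⇒∣ᵤ m∣x-y) (∣⇒∣ᵤ k∣x-y)))

pos-1+*≡* : ∀ i j k l → 1 ℕ.+ i ℕ.* j ≡ k ℕ.* l → 1ℤ + + i * + j ≡ + k * + l
pos-1+*≡* i j k l eq = begin
  1ℤ + + i * + j      ≡⟨ cong (λ v → 1ℤ + v) (ℤ.pos-* i j) ⟨
  1ℤ + + (i ℕ.* j)    ≡⟨ ℤ.pos-+ 1 (i ℕ.* j) ⟨
  + (1 ℕ.+ i ℕ.* j)   ≡⟨ cong +_ eq ⟩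
  + (k ℕ.* l)         ≡⟨ ℤ.pos-* k l ⟩
  + k * + l           ∎
  where open ≡-Reasoning

coprime⇒invertibleℕ : Coprime m t → ∃[ u ] (u * + t ≡ 1ℤ mod m)
coprime⇒invertibleℕ {m} {t} m⊥t with coprime-Bézout m⊥t
... | Bézout.+- i j 1+jt≡im = - + j , congruent (divides (- + i) (begin
  (- + j) * + t - 1ℤ   ≡⟨ negate (+ j) (+ t) ⟩
  - (1ℤ + + j * + t)   ≡⟨ cong -_ (pos-1+*≡* j t i m 1+jt≡im) ⟩
  - (+ i * + m)        ≡⟨ ℤ.neg-distribˡ-* (+ i) (+ m) ⟩
  (- + i) * + m        ∎))
  where
  open ≡-Reasoning
  negate : ∀ j t → (- j) * t - 1ℤ ≡ - (1ℤ + j * t)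
  negate = solve-∀
... | Bézout.-+ i j 1+im≡jt = + j , congruent (divides (+ i) (begin
  + j * + t - 1ℤ       ≡⟨ cong (_- 1ℤ) (pos-1+*≡* i m j t 1+im≡jt) ⟨
  1ℤ + + i * + m - 1ℤ  ≡⟨ cancel (+ i * + m) ⟩
  + i * + m            ∎))
  where
  open ≡-Reasoning
  cancel : ∀ a → 1ℤ + a - 1ℤ ≡ a
  cancel = solve-∀

coprime⇒invertible : ∀ y → Coprime m ∣ y ∣ → ∃[ u ] (u * y ≡ 1ℤ mod m)
coprime⇒invertible {m} y m⊥∣y∣ with coprime⇒invertibleℕ m⊥∣y∣ | ℤ.+∣i∣≡i⊎+∣i∣≡-i y
... | u , u∣y∣≡1 | inj₁ ∣y∣≡y  = u , subst (λ v → u * v ≡ 1ℤ mod m) ∣y∣≡y u∣y∣≡1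
... | u , u∣y∣≡1 | inj₂ ∣y∣≡-y = - u , subst (_≡ 1ℤ mod m) u∣y∣≡-uy u∣y∣≡1
  where
  u∣y∣≡-uy : u * + ∣ y ∣ ≡ - u * y
  u∣y∣≡-uy = trans (cong (u *_) ∣y∣≡-y) (trans (sym (ℤ.neg-distribʳ-* u y)) (ℤ.neg-distribˡ-* u y))

chineseRemainder : Coprime m k → ∀ x y → ∃[ z ] (z ≡ x mod m × z ≡ y mod k)
chineseRemainder {m} {k} m⊥k x y with coprime⇒invertible (+ m) (Cop.sym m⊥k)
... | u , congruent k∣um-1 = x + (y - x) * u * + m
                           , congruent (divides ((y - x) * u) (shift x y u (+ m)))
                           , congruent (subst (_ ∣ℤ_) (rearrange x y u (+ m))
                                              (ℤ∣.∣n⇒∣m*n (y - x) k∣um-1))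
  where
  shift : ∀ x y u m → x + (y - x) * u * m - x ≡ (y - x) * u * m
  shift = solve-∀
  rearrange : ∀ x y u m → (y - x) * (u * m - 1ℤ) ≡ x + (y - x) * u * m - y
  rearrange = solve-∀

IsSquareMod : ℤ → ℕ → Set
IsSquareMod D m = ∃[ b ] (b * b ≡ D mod m)

∣⇒isSquareMod : + m ∣ℤ D → IsSquareMod D m
∣⇒isSquareMod {D = D} m∣D = 0ℤ , congruent (subst (_ ∣ℤ_) (sym (ℤ.+-identityˡ (- D))) (ℤ∣.∣m⇒∣-m m∣D))

isSquareMod-resp : D ≡ D′ mod m → IsSquareMod D m → IsSquareMod D′ m
isSquareMod-resp D≡D′ (b , b²≡D) = b , ≡mod-trans b²≡D D≡D′

isSquareMod-∣ : m ℕD.∣ k → IsSquareMod D k → IsSquareMod D m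
isSquareMod-∣ m∣k (b , b²≡D) = b , ≡mod-∣ m∣k b²≡D

isSquareMod-* : Coprime m k → IsSquareMod D m → IsSquareMod D k → IsSquareMod D (m ℕ.* k)
isSquareMod-* {m} {k} {D} m⊥k (b₁ , b₁²≡D) (b₂ , b₂²≡D) =
  let b , b≡b₁ , b≡b₂ = chineseRemainder m⊥k b₁ b₂
  in b , ≡mod-coprime-* {x = b * b} {D} m⊥k (≡mod-trans (≡mod-* b≡b₁ b≡b₁) b₁²≡D)
                                      (≡mod-trans (≡mod-* b≡b₂ b≡b₂) b₂²≡D)

isSquareMod⇔residue : ∀ D m .{{_ : NonZero m}} →
                      IsSquareMod D m ⇔ Any (λ r → + m ∣ℤ + r * + r - D) (upTo m)
isSquareMod⇔residue D m =
  mk⇔ residue (λ any → let r , m∣r²-D = Any.satisfied any in + r , congruent m∣r²-D)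
  where
  residue : IsSquareMod D m → Any (λ r → + m ∣ℤ + r * + r - D) (upTo m)
  residue (b , b²≡D) = Any.map (λ { refl → ∣-diff (≡mod-trans (≡mod-* r≡b r≡b) b²≡D) })
                               (∈-upTo⁺ (n%ℕd<d b m))
    where
    r≡b = ≡mod-sym (≡mod-%ℕ b m)

isSquareMod? : ∀ D m .{{_ : NonZero m}} → Dec (IsSquareMod D m)
isSquareMod? D m = Dec.map′ from to (any? (λ r → + m ℤ∣.∣? (+ r * + r - D)) (upTo m))
  where open Equivalence (isSquareMod⇔residue D m)

kronecker-odd≡-1⇔¬isSquareMod : ∀ D k → kronecker D (3 ℕ.+ k) ≡ -1ℤ ⇔ (¬ IsSquareMod D (3 ℕ.+ k))
kronecker-odd≡-1⇔¬isSquareMod D k =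
  cases (+ (3 ℕ.+ k) ℤ∣.∣? D) (any? (λ r → + (3 ℕ.+ k) ℤ∣.∣? (+ r * + r - D)) (upTo (3 ℕ.+ k)))
  where
  open Equivalence (isSquareMod⇔residue D (3 ℕ.+ k))
  -- kronecker D (3 + k) unfolds to this conditional; abstracting both decisions
  -- lets us split on them.
  cases : (p∣D? : Dec (+ (3 ℕ.+ k) ∣ℤ D))
          (residue? : Dec (Any (λ r → + (3 ℕ.+ k) ∣ℤ + r * + r - D) (upTo (3 ℕ.+ k)))) →
          (if does p∣D? then 0ℤ else if does residue? then 1ℤ else -1ℤ) ≡ -1ℤ ⇔
          (¬ IsSquareMod D (3 ℕ.+ k))
  cases (yes p∣D) _         = mk⇔ (λ ()) (λ ¬sq → contradiction (∣⇒isSquareMod p∣D) ¬sq)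
  cases (no _) (yes residue) = mk⇔ (λ ()) (λ ¬sq → contradiction (from residue) ¬sq)
  cases (no _) (no ¬residue) = mk⇔ (λ _ → ¬residue ∘ to) (λ _ → refl)

kronecker2≡-1⇔¬isSquareMod8 : ∀ {r} → r ℕ.< 8 → IsSquareMod (+ r) 4 →
                           kronecker2 r ≡ -1ℤ ⇔ (¬ IsSquareMod (+ r) 8)
kronecker2≡-1⇔¬isSquareMod8 r<8 sq4 = let to , from = table r<8 sq4 in mk⇔ to from
  where
  table : ∀ {r} → r ℕ.< 8 → IsSquareMod (+ r) 4 →
          (kronecker2 r ≡ -1ℤ → ¬ IsSquareMod (+ r) 8) × (¬ IsSquareMod (+ r) 8 → kronecker2 r ≡ -1ℤ)
  table = from-yes (ℕ.allUpTo? (λ r → isSquareMod? (+ r) 4 →-dec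
                                      (kronecker2 r ℤ.≟ -1ℤ →-dec ¬? (isSquareMod? (+ r) 8)) ×-dec
                                      (¬? (isSquareMod? (+ r) 8) →-dec kronecker2 r ℤ.≟ -1ℤ)) 8)

kronecker-two≡-1⇔¬isSquareMod8 : IsSquareMod D 4 → kronecker D 2 ≡ -1ℤ ⇔ (¬ IsSquareMod D 8)
kronecker-two≡-1⇔¬isSquareMod8 {D} sq4 =
  mk⇔ (λ k≡-1 → to k≡-1 ∘ isSquareMod-resp D≡r) (λ ¬sq → from (¬sq ∘ isSquareMod-resp (≡mod-sym D≡r)))
  where
  D≡r = ≡mod-%ℕ D 8
  open Equivalence (kronecker2≡-1⇔¬isSquareMod8 (n%ℕd<d D 8)
                                              (isSquareMod-resp (≡mod-∣ (ℕD.divides 2 refl) D≡r) sq4))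

coprime-4-oddPrime : Prime (3 ℕ.+ k) → Coprime 4 (3 ℕ.+ k)
coprime-4-oddPrime {k} pr = coprime-*ˡ 2⊥p 2⊥p
  where
  2⊥p = Cop.sym (prime⇒coprime pr (ℕ.m≤m+n 3 k))

kronecker≢-1⇒isSquareMod4p : Prime p → IsSquareMod D 4 → ¬ kronecker D p ≡ -1ℤ →
                             IsSquareMod D (4 ℕ.* p)
kronecker≢-1⇒isSquareMod4p {2} {D} _ sq4 k≢-1 =
  decidable-stable (isSquareMod? D 8) (k≢-1 ∘ Equivalence.from (kronecker-two≡-1⇔¬isSquareMod8 sq4))
kronecker≢-1⇒isSquareMod4p {suc (suc (suc k))} {D} pr sq4 k≢-1 =
  isSquareMod-* (coprime-4-oddPrime pr) sq4 sqp
  where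
  sqp = decidable-stable (isSquareMod? D _) (k≢-1 ∘ Equivalence.from (kronecker-odd≡-1⇔¬isSquareMod D k))

squarefree⇒p²∤ : Squarefree s → Prime p → ¬ (p ℕ.* p) ℕD.∣ s
squarefree⇒p²∤ sqf pr p²∣s = nonTrivial⇒≢1 {{prime⇒nonTrivial pr}} (sqf _ p²∣s)

isSquareMod-4*-prime : Prime p → ¬ p ℕD.∣ n → IsSquareMod D (4 ℕ.* p) → IsSquareMod D (4 ℕ.* n) →
                       IsSquareMod D (4 ℕ.* (p ℕ.* n))
isSquareMod-4*-prime {2} {n} pr 2∤n sq8 sq4n =
  subst (IsSquareMod _) (ℕ.*-assoc 4 2 n) (isSquareMod-* 8⊥n sq8 (isSquareMod-∣ (ℕD.n∣m*n 4) sq4n))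
  where
  2⊥n = prime∤⇒coprime pr 2∤n
  8⊥n = coprime-*ˡ 2⊥n (coprime-*ˡ 2⊥n 2⊥n)
isSquareMod-4*-prime {p@(suc (suc (suc _)))} {n} pr p∤n sq4p sq4n =
  subst (IsSquareMod _) (reorder 4 n p) (isSquareMod-* 4n⊥p sq4n (isSquareMod-∣ (ℕD.n∣m*n 4) sq4p))
  where
  4n⊥p = coprime-*ˡ (coprime-4-oddPrime pr) (Cop.sym (prime∤⇒coprime pr p∤n))
  reorder : ∀ a n p → a ℕ.* n ℕ.* p ≡ a ℕ.* (p ℕ.* n)
  reorder = ℕSolver.solve-∀

squarefree-local⇒global : Squarefree s → .{{_ : NonZero s}} → IsSquareMod D 4 →
                          (∀ {p} → Prime p → p ℕD.∣ s → IsSquareMod D (4 ℕ.* p)) →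
                          IsSquareMod D (4 ℕ.* s)
squarefree-local⇒global {s} {D} sqf sq4 local =
  subst (λ n → IsSquareMod D (4 ℕ.* n)) (sym isFactorisation)
        (glue factorsPrime (ℕD.∣-reflexive (sym isFactorisation)))
  where
  open PrimeFactorisation (factorise s)
  glue : ∀ {ps} → All Prime ps → product ps ℕD.∣ s → IsSquareMod D (4 ℕ.* product ps)
  glue All.[] _ = sq4
  glue {p ∷ ps} (pr All.∷ prs) p∏∣s =
    isSquareMod-4*-prime pr p∤∏ (local pr (ℕD.∣-trans (ℕD.m∣m*n _) p∏∣s))
                                (glue prs (ℕD.∣-trans (ℕD.n∣m*n p) p∏∣s))
    where
    p∤∏ : ¬ p ℕD.∣ product ps
    p∤∏ p∣∏ = squarefree⇒p²∤ sqf pr (ℕD.∣-trans (ℕD.*-monoʳ-∣ p p∣∏) p∏∣s)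

Q-completeSquare : ∀ a b c x y →
  (+ 4 * a) * Q a b c x y ≡ (+ 2 * a * x + b * y) * (+ 2 * a * x + b * y) - disc a b c * (y * y)
Q-completeSquare = expanded
  where
  expanded : ∀ a b c x y → (+ 4 * a) * (a * x * x + b * x * y + c * y * y) ≡
             (+ 2 * a * x + b * y) * (+ 2 * a * x + b * y) - (b * b - + 4 * a * c) * (y * y)
  expanded = solve-∀

Q-swap : ∀ a b c x y → Q a b c x y ≡ Q c b a y x
Q-swap = expanded
  where
  expanded : ∀ a b c x y → a * x * x + b * x * y + c * y * y ≡ c * y * y + b * y * x + a * x * x
  expanded = solve-∀

disc-swap : ∀ a b c → disc a b c ≡ disc c b a
disc-swap = expanded
  where
  expanded : ∀ a b c → b * b - + 4 * a * c ≡ b * b - + 4 * c * a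
  expanded = solve-∀

Q-scale : ∀ a b c x y k → Q a b c (x * k) (y * k) ≡ Q a b c x y * (k * k)
Q-scale = expanded
  where
  expanded : ∀ a b c x y k → a * (x * k) * (x * k) + b * (x * k) * (y * k) + c * (y * k) * (y * k) ≡
             (a * x * x + b * x * y + c * y * y) * (k * k)
  expanded = solve-∀

disc-isSquareMod4 : ∀ a b c → IsSquareMod (disc a b c) 4
disc-isSquareMod4 a b c = b , congruent (divides (a * c) (b²-disc a b c))
  where
  b²-disc : ∀ a b c → b * b - (b * b - + 4 * a * c) ≡ a * c * + 4
  b²-disc = solve-∀

isSquareMod-invertible : ∀ w y → w * w ≡ D * (y * y) mod m → ∃[ u ] (u * y ≡ 1ℤ mod m) → IsSquareMod D m
isSquareMod-invertible {D = D} w y (congruent m∣w²-Dy²) (u , congruent m∣uy-1) =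
  u * w , congruent (subst (_ ∣ℤ_) (expand u w D y)
                           (ℤ∣.∣m∣n⇒∣m+n (ℤ∣.∣n⇒∣m*n (u * u) m∣w²-Dy²)
                                         (ℤ∣.∣n⇒∣m*n D (ℤ∣.∣m⇒∣m*n (u * y + 1ℤ) m∣uy-1))))
  where
  expand : ∀ u w D y →
           u * u * (w * w - D * (y * y)) + D * ((u * y - 1ℤ) * (u * y + 1ℤ)) ≡ u * w * (u * w) - D
  expand = solve-∀

isSquareMod-disc : ∀ a b c x y → + m ∣ℤ (+ 4 * a) * Q a b c x y → ∃[ u ] (u * y ≡ 1ℤ mod m) →
                   IsSquareMod (disc a b c) m
isSquareMod-disc a b c x y m∣4aQ =
  isSquareMod-invertible (+ 2 * a * x + b * y) y
                         (congruent (subst (_ ∣ℤ_) (Q-completeSquare a b c x y) m∣4aQ))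

prime∣Q⇒∣y : ∀ a b c x y → Prime p → kronecker (disc a b c) p ≡ -1ℤ → + p ∣ℤ Q a b c x y → + p ∣ℤ y
prime∣Q⇒∣y {2} a b c x y pr k≡-1 (divides q Q≡q*2) with + 2 ℤ∣.∣? y
... | yes 2∣y = 2∣y
... | no 2∤y = contradiction (isSquareMod-disc a b c x y 8∣4aQ (coprime⇒invertible y 8⊥y))
                             (Equivalence.to (kronecker-two≡-1⇔¬isSquareMod8 (disc-isSquareMod4 a b c)) k≡-1)
  where
  2⊥y = prime∤⇒coprime pr (2∤y ∘ ∣ᵤ⇒∣)
  8⊥y = coprime-*ˡ 2⊥y (coprime-*ˡ 2⊥y 2⊥y)
  regroup : ∀ a q → + 4 * a * (q * + 2) ≡ a * q * + 8
  regroup = solve-∀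
  8∣4aQ : + 8 ∣ℤ (+ 4 * a) * Q a b c x y
  8∣4aQ = divides (a * q) (trans (cong (+ 4 * a *_) Q≡q*2) (regroup a q))
prime∣Q⇒∣y {p@(suc (suc (suc k)))} a b c x y pr k≡-1 p∣Q with + p ℤ∣.∣? y
... | yes p∣y = p∣y
... | no p∤y = contradiction (isSquareMod-disc a b c x y (ℤ∣.∣n⇒∣m*n (+ 4 * a) p∣Q)
                                               (coprime⇒invertible y p⊥y))
                             (Equivalence.to (kronecker-odd≡-1⇔¬isSquareMod (disc a b c) k) k≡-1)
  where
  p⊥y = prime∤⇒coprime pr (p∤y ∘ ∣ᵤ⇒∣)

prime∣Q⇒∣x×∣y : ∀ a b c x y → Prime p → kronecker (disc a b c) p ≡ -1ℤ → + p ∣ℤ Q a b c x y →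
                + p ∣ℤ x × + p ∣ℤ y
prime∣Q⇒∣x×∣y {p} a b c x y pr k≡-1 p∣Q =
  prime∣Q⇒∣y c b a y x pr (subst (λ D → kronecker D p ≡ -1ℤ) (disc-swap a b c) k≡-1)
                (subst (_ ∣ℤ_) (Q-swap a b c x y) p∣Q) ,
  prime∣Q⇒∣y a b c x y pr k≡-1 p∣Q

prime∣t*m²⇒∣m : ∀ t m → Prime p → ¬ + p ∣ℤ t → + p ∣ℤ t * (m * m) → + p ∣ℤ m
prime∣t*m²⇒∣m t m pr p∤t p∣tm² with euclidsLemmaℤ t (m * m) pr p∣tm²
... | inj₁ p∣t  = contradiction p∣t p∤t
... | inj₂ p∣m² = Sum.reduce (euclidsLemmaℤ m m pr p∣m²)

N*p²≡p*t*m²⇒N≡p*t*m′² : ∀ N t m → Prime p → ¬ + p ∣ℤ t → N * (+ p * + p) ≡ + p * t * (m * m) →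
            ∃[ m′ ] (m ≡ m′ * + p × N ≡ + p * t * (m′ * m′))
N*p²≡p*t*m²⇒N≡p*t*m′² {p} N t m pr p∤t Np²≡ptm² =
  m′ , m≡m′p , ℤ.*-cancelʳ-≡ N (+ p * t * (m′ * m′)) (+ p) (begin
    N * + p                       ≡⟨ Np≡tm² ⟩
    t * (m * m)                   ≡⟨ cong (λ v → t * (v * v)) m≡m′p ⟩
    t * (m′ * + p * (m′ * + p))   ≡⟨ regroup t m′ (+ p) ⟩
    + p * t * (m′ * m′) * + p     ∎)
  where
  open ≡-Reasoning
  instance
    p≢0 : ℕ.NonZero p
    p≢0 = prime⇒nonZero pr
  reassoc : ∀ N p → N * p * p ≡ N * (p * p)
  reassoc = solve-∀
  rotate : ∀ p t m² → p * t * m² ≡ t * m² * p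
  rotate = solve-∀
  regroup : ∀ t m′ p → t * (m′ * p * (m′ * p)) ≡ p * t * (m′ * m′) * p
  regroup = solve-∀
  Np≡tm² : N * + p ≡ t * (m * m)
  Np≡tm² = ℤ.*-cancelʳ-≡ (N * + p) (t * (m * m)) (+ p)
             (trans (reassoc N (+ p)) (trans Np²≡ptm² (rotate (+ p) t (m * m))))
  open ℤ∣._∣_ (prime∣t*m²⇒∣m t m pr p∤t (divides N (sym Np≡tm²)))
    renaming (quotient to m′; equality to m≡m′p)

prime∣Q⇒Q≡Q′*p² : ∀ a b c x y → Prime p → kronecker (disc a b c) p ≡ -1ℤ → + p ∣ℤ Q a b c x y →
                     ∃[ x′ ] ∃[ y′ ] (Q a b c x y ≡ Q a b c x′ y′ * (+ p * + p))
prime∣Q⇒Q≡Q′*p² {p} a b c x y pr k≡-1 p∣Q with prime∣Q⇒∣x×∣y a b c x y pr k≡-1 p∣Q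
... | divides x′ refl , divides y′ refl = x′ , y′ , Q-scale a b c x′ y′ (+ p)

∣m∣<∣m*p∣ : ∀ m → m ≢ 0ℤ → Prime p → ∣ m ∣ ℕ.< ∣ m * + p ∣
∣m∣<∣m*p∣ {p} m m≢0 pr = subst (∣ m ∣ ℕ.<_) (sym (ℤ.abs-* m (+ p)))
  (ℕ.m<m*n ∣ m ∣ p {{ℕ.≢-nonZero (m≢0 ∘ ℤ.∣i∣≡0⇒i≡0)}} (nonTrivial⇒n>1 p {{prime⇒nonTrivial pr}}))

descent-step : ∀ a b c t x y m → Prime p → kronecker (disc a b c) p ≡ -1ℤ → ¬ + p ∣ℤ t → m ≢ 0ℤ →
               Q a b c x y ≡ + p * t * (m * m) →
               ∃[ x′ ] ∃[ y′ ] ∃[ m′ ] (∣ m′ ∣ ℕ.< ∣ m ∣ × m′ ≢ 0ℤ × Q a b c x′ y′ ≡ + p * t * (m′ * m′))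
descent-step {p} a b c t x y m pr k≡-1 p∤t m≢0 Q≡ptm² =
  let x′ , y′ , Q≡Q′p² = prime∣Q⇒Q≡Q′*p² a b c x y pr k≡-1 p∣Q
      m′ , m≡m′p , Q′≡ptm′² = N*p²≡p*t*m²⇒N≡p*t*m′² (Q a b c x′ y′) t m pr p∤t (trans (sym Q≡Q′p²) Q≡ptm²)
      m′≢0 = λ m′≡0 → m≢0 (trans m≡m′p (cong (_* + p) m′≡0))
  in x′ , y′ , m′ , subst (λ v → ∣ m′ ∣ ℕ.< ∣ v ∣) (sym m≡m′p) (∣m∣<∣m*p∣ m′ m′≢0 pr) , m′≢0 , Q′≡ptm′²
  where
  rotate : ∀ p t m² → p * t * m² ≡ t * m² * p
  rotate = solve-∀
  p∣Q : + p ∣ℤ Q a b c x y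
  p∣Q = divides (t * (m * m)) (trans Q≡ptm² (rotate (+ p) t (m * m)))

Q≢p*t*m² : ∀ a b c t → Prime p → kronecker (disc a b c) p ≡ -1ℤ → ¬ + p ∣ℤ t →
           ∀ m → m ≢ 0ℤ → ∀ x y → Q a b c x y ≢ + p * t * (m * m)
Q≢p*t*m² {p} a b c t pr k≡-1 p∤t m = descent m (<-wellFounded ∣ m ∣)
  where
  descent : ∀ m → Acc ℕ._<_ ∣ m ∣ → m ≢ 0ℤ → ∀ x y → Q a b c x y ≢ + p * t * (m * m)
  descent m (acc smaller) m≢0 x y Q≡ptm² =
    let x′ , y′ , m′ , ∣m′∣<∣m∣ , m′≢0 , Q′≡ptm′² = descent-step a b c t x y m pr k≡-1 p∤t m≢0 Q≡ptm²
    in descent m′ (smaller ∣m′∣<∣m∣) m′≢0 x′ y′ Q′≡ptm′²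

NonResiduePrimeDivisor : ℤ → ℕ → Set
NonResiduePrimeDivisor D s = ∃[ p ] (Prime p × p ℕD.∣ s × kronecker D p ≡ -1ℤ)

RepresentedByPrimitiveForm : ℤ → ℕ → Set
RepresentedByPrimitiveForm D n =
  ∃[ a ] ∃[ b ] ∃[ c ] (PosDef a b c × NormOne a b c × disc a b c ≡ D × Represents a b c n)

isSquarefreePart⇒nonZero : .{{_ : NonZero n}} → IsSquarefreePart n s → NonZero s
isSquarefreePart⇒nonZero {n} (_ , m , n≡sm²) =
  ℕ.≢-nonZero (λ s≡0 → ℕ.≢-nonZero⁻¹ n (trans n≡sm² (cong (ℕ._* (m ℕ.* m)) s≡0)))

nonResidue⇒¬represented : .{{_ : NonZero n}} → IsSquarefreePart n s →
                          NonResiduePrimeDivisor D s → ¬ RepresentedByPrimitiveForm D n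
nonResidue⇒¬represented {n} {s} (sqf , m , n≡sm²) (p , pr , ℕD.divides t s≡tp , k≡-1)
                        (a , b , c , _ , _ , refl , x , y , Q≡n) =
  Q≢p*t*m² a b c (+ t) pr k≡-1 p∤t (+ m) m≢0 x y (trans Q≡n n≡ptm²)
  where
  p∤t : ¬ + p ∣ℤ + t
  p∤t p∣t = squarefree⇒p²∤ sqf pr (subst (_ ℕD.∣_) (sym s≡tp) (ℕD.*-monoˡ-∣ p (∣⇒∣ᵤ p∣t)))
  m≢0 : + m ≢ 0ℤ
  m≢0 m≡0 = ℕ.≢-nonZero⁻¹ n (begin
    n                ≡⟨ n≡sm² ⟩
    s ℕ.* (m ℕ.* m)  ≡⟨ cong (λ v → s ℕ.* (v ℕ.* v)) (ℤ.+-injective m≡0) ⟩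
    s ℕ.* 0          ≡⟨ ℕ.*-zeroʳ s ⟩
    0                ∎)
    where open ≡-Reasoning
  commute : ∀ t p m → t * p * (m * m) ≡ p * t * (m * m)
  commute = solve-∀
  n≡ptm² : + n ≡ + p * + t * (+ m * + m)
  n≡ptm² = begin
    + n                                 ≡⟨ cong +_ (trans n≡sm² (cong (ℕ._* (m ℕ.* m)) s≡tp)) ⟩
    + (t ℕ.* p ℕ.* (m ℕ.* m))           ≡⟨ ℤ.pos-* (t ℕ.* p) (m ℕ.* m) ⟩
    + (t ℕ.* p) * + (m ℕ.* m)           ≡⟨ cong₂ _*_ (ℤ.pos-* t p) (ℤ.pos-* m m) ⟩
    + t * + p * (+ m * + m)             ≡⟨ commute (+ t) (+ p) (+ m) ⟩
    + p * + t * (+ m * + m)             ∎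
    where open ≡-Reasoning

discriminant⇒isSquareMod4 : (+ 4 ∣ D) ⊎ (+ 4 ∣ D - + 1) → IsSquareMod D 4
discriminant⇒isSquareMod4 (inj₁ 4∣D)   = ∣⇒isSquareMod (∣ᵤ⇒∣ 4∣D)
discriminant⇒isSquareMod4 {D} (inj₂ 4∣D-1) =
  1ℤ , congruent (subst (_ ∣ℤ_) (negate D) (ℤ∣.∣m⇒∣-m (∣ᵤ⇒∣ 4∣D-1)))
  where
  negate : ∀ D → - (D - 1ℤ) ≡ 1ℤ * 1ℤ - D
  negate = solve-∀

isSquareMod4s⇒primitiveForm : .{{_ : NonZero s}} → s ℕD.∣ n → Coprime n ∣ D ∣ → D < 0ℤ →
                              IsSquareMod D (4 ℕ.* s) →
                              ∃[ b ] ∃[ c ] (PosDef (+ s) b c × NormOne (+ s) b c × disc (+ s) b c ≡ D)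
isSquareMod4s⇒primitiveForm {s} {n} {D} s∣n n⊥D D<0 (b , congruent (divides c b²-D≡c*4s)) =
  b , c , (ℤ.+<+ (ℕ.>-nonZero⁻¹ s) , subst (_< 0ℤ) (sym disc≡D) D<0) , normOne , disc≡D
  where
  open ≡-Reasoning
  regroup : ∀ s c → + 4 * s * c ≡ c * (+ 4 * s)
  regroup = solve-∀
  cancel : ∀ b D → b * b - (b * b - D) ≡ D
  cancel = solve-∀
  disc≡D : disc (+ s) b c ≡ D
  disc≡D = begin
    b * b - + 4 * + s * c       ≡⟨ cong (λ v → b * b - v) (regroup (+ s) c) ⟩
    b * b - c * (+ 4 * + s)     ≡⟨ cong (λ v → b * b - c * v) (ℤ.pos-* 4 s) ⟨
    b * b - c * + (4 ℕ.* s)     ≡⟨ cong (λ v → b * b - v) b²-D≡c*4s ⟨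
    b * b - (b * b - D)         ≡⟨ cancel b D ⟩
    D                           ∎
  g = ℕGCD.gcd s ∣ b ∣
  g∣s = ℕGCD.gcd[m,n]∣m s ∣ b ∣
  g∣b : + g ∣ℤ b
  g∣b = ∣ᵤ⇒∣ (ℕGCD.gcd[m,n]∣n s ∣ b ∣)
  g∣+s : + g ∣ℤ + s
  g∣+s = ∣ᵤ⇒∣ g∣s
  g∣D : + g ∣ℤ D
  g∣D = subst (+ g ∣ℤ_) disc≡D (ℤ∣.∣m∣n⇒∣m-n (ℤ∣.∣m⇒∣m*n b g∣b) (ℤ∣.∣m⇒∣m*n c (ℤ∣.∣n⇒∣m*n (+ 4) g∣+s)))
  normOne : NormOne (+ s) b c
  normOne = trans (cong (λ g → ℤGCD.gcd (+ g) c) (n⊥D (ℕD.∣-trans g∣s s∣n , ∣⇒∣ᵤ g∣D))) (ℤGCD.gcd-zeroˡ c)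

¬nonResidue⇒represented : .{{_ : NonZero n}} → IsSquarefreePart n s → D < 0ℤ → IsSquareMod D 4 →
                          Coprime n ∣ D ∣ → ¬ NonResiduePrimeDivisor D s → RepresentedByPrimitiveForm D n
¬nonResidue⇒represented {n} {s} {D} sfp@(sqf , m , n≡sm²) D<0 sq4 n⊥D ¬nonRes =
  let b , c , posDef , normOne , disc≡D = isSquareMod4s⇒primitiveForm s∣n n⊥D D<0 sq4s
  in + s , b , c , posDef , normOne , disc≡D , + m , 0ℤ , Q≡n b c
  where
  instance
    s≢0 : NonZero s
    s≢0 = isSquarefreePart⇒nonZero sfp
  s∣n : s ℕD.∣ n
  s∣n = ℕD.divides (m ℕ.* m) (trans n≡sm² (ℕ.*-comm s (m ℕ.* m)))
  sq4s : IsSquareMod D (4 ℕ.* s)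
  sq4s = squarefree-local⇒global sqf sq4 λ pr p∣s →
           kronecker≢-1⇒isSquareMod4p pr sq4 (λ k≡-1 → ¬nonRes (_ , pr , p∣s , k≡-1))
  evaluate : ∀ s b c m → s * m * m + b * m * 0ℤ + c * 0ℤ * 0ℤ ≡ s * (m * m)
  evaluate = solve-∀
  Q≡n : ∀ b c → Q (+ s) b c (+ m) 0ℤ ≡ + n
  Q≡n b c = begin
    Q (+ s) b c (+ m) 0ℤ        ≡⟨ evaluate (+ s) b c (+ m) ⟩
    + s * (+ m * + m)           ≡⟨ cong (+ s *_) (ℤ.pos-* m m) ⟨
    + s * + (m ℕ.* m)           ≡⟨ ℤ.pos-* s (m ℕ.* m) ⟨
    + (s ℕ.* (m ℕ.* m))         ≡⟨ cong +_ n≡sm² ⟨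
    + n                         ∎
    where open ≡-Reasoning

nonResiduePrimeDivisor? : ∀ D s .{{_ : NonZero s}} → Dec (NonResiduePrimeDivisor D s)
nonResiduePrimeDivisor? D s =
  Dec.map′ (λ (p , _ , h) → p , h) (λ (p , h@(_ , p∣s , _)) → p , ℕ.s≤s (ℕD.∣⇒≤ p∣s) , h)
           (ℕ.anyUpTo? (λ p → prime? p ×-dec p ℕD.∣? s ×-dec kronecker D p ℤ.≟ -1ℤ) (suc s))

lemma2p5 : (n : ℕ) → .{{_ : NonZero n}} → (s : ℕ) → IsSquarefreePart n s →
           (D : ℤ) → D < + 0 → (((+ 4) ∣ D) ⊎ ((+ 4) ∣ (D - + 1))) →
           Coprime n ∣ D ∣ →
           ((¬ (∃[ a ] ∃[ b ] ∃[ c ]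
                 (PosDef a b c × NormOne a b c × disc a b c ≡ D × Represents a b c n)))
            ⇔ (∃[ p ] (Prime p × p ℕD.∣ s × kronecker D p ≡ - (+ 1))))
lemma2p5 n s sfp D D<0 D≡0,1 n⊥D =
  mk⇔ (λ ¬rep → decidable-stable (nonResiduePrimeDivisor? D s)
                  (¬rep ∘ ¬nonResidue⇒represented sfp D<0 (discriminant⇒isSquareMod4 D≡0,1) n⊥D))
      (nonResidue⇒¬represented sfp)
  where
  instance
    s≢0 : NonZero s
    s≢0 = isSquarefreePart⇒nonZero sfp
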